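{- Let $G$ be a finite abelian group, $H\subset G$ a subgroup, $\Gamma=G/H$, $\mathcal{A}_H\subset\mathbb{Z}[H]$ the augmentation ideal and $J_H=\mathbb{Z}[G]\mathcal{A}_H$. Define $\psi:\mathbb{Z}[G]\to\mathbb{Z}[G]\otimes_{\mathbb{Z}}\mathbb{Z}[H]$ by $\psi(\rho)=\sum_{h\in H}h\rho\otimes h^{ -1}$. Then: (i) $\psi$ is an injective $\mathbb{Z}[G]$-module homomorphism, where $G$ acts on $\mathbb{Z}[G]\otimes\mathbb{Z}[H]$ through the left factor; (ii) $\psi(h\rho)=\psi(\rho)\cdot(1\otimes h)$ for every $h\in H$ and $\rho\in\mathbb{Z}[G]$; (iii) $\psi(J_H^t)\subset\mathbb{Z}[G]\otimes_{\mathbb{Z}}\mathcal{A}_H^t$ for every $t\ge0$; (iv) for every $t\ge0$, $\psi$ induces an injective map $J_H^t/J_H^{t+1}\to\mathbb{Z}[G]\otimes_{\mathbb{Z}}\mathcal{A}_H^t/\mathcal{A}_H^{t+1}$, and its composite with the isomorphism $\mathbb{Z}[\Gamma]\otimes_{\mathbb{Z}}\mathcal{A}_H^t/\mathcal{A}_H^{t+1}\xrightarrow{\sim}J_H^t/J_H^{t+1}$, $\gamma\otimes\alpha\mapsto\alpha\bar\gamma$ ($\bar\gamma$ any lift of $\gamma$ to $\mathbb{Z}[G]$), equals $\iota\otimes1$, where $\iota:\mathbb{Z}[\Gamma]\to\mathbb{Z}[G]$, $\gamma\mapsto\sum_{g\in G,\,gH=\gamma}g$. -}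

module Defs where

open import Data.Nat using (ℕ; zero; suc)
open import Data.Fin using (Fin; _≟_)
open import Data.Fin.Properties using ()
open import Data.Integer using (ℤ; 0ℤ; 1ℤ; _+_; _*_; -_)
open import Data.List using (List; foldr; allFin)
open import Data.Bool using (Bool; true; false; if_then_else_)
open import Data.Product using (_×_; _,_; ∃; ∃-syntax)
open import Data.Unit using (⊤)
open import Relation.Nullary.Decidable using (⌊_⌋)
open import Relation.Binary.PropositionalEquality using (_≡_)

-- Finite abelian groups, concretely: the carrier is Fin n (every finite
-- group is isomorphic to one of this form), with propositional equality.

record FinAbGroup : Set where
  infixl 7 _∙_
  field
    n       : ℕ
    _∙_     : Fin n → Fin n → Fin n
    e       : Fin n
    _⁻¹     : Fin n → Fin n
    assoc   : ∀ x y z → (x ∙ y) ∙ z ≡ x ∙ (y ∙ z)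
    comm    : ∀ x y → x ∙ y ≡ y ∙ x
    identityˡ : ∀ x → e ∙ x ≡ x
    inverseˡ  : ∀ x → (x ⁻¹) ∙ x ≡ e

record Subgroup (G : FinAbGroup) : Set where
  open FinAbGroup G
  field
    isH    : Fin n → Bool
    e∈     : isH e ≡ true
    ∙∈     : ∀ x y → isH x ≡ true → isH y ≡ true → isH (x ∙ y) ≡ true
    ⁻¹∈    : ∀ x → isH x ≡ true → isH (x ⁻¹) ≡ true

-- Free abelian groups Z[I] on a finite index type I, as functions I → ℤ
-- (finite support is automatic), with pointwise structure.

module _ {I : Set} where
  _≈_ : (I → ℤ) → (I → ℤ) → Set
  f ≈ g = ∀ i → f i ≡ g i

  _⊕_ : (I → ℤ) → (I → ℤ) → (I → ℤ)
  (f ⊕ g) i = f i + g i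

  ⊖_ : (I → ℤ) → (I → ℤ)
  (⊖ f) i = - f i

  𝟘 : I → ℤ
  𝟘 _ = 0ℤ

  _⊝_ : (I → ℤ) → (I → ℤ) → (I → ℤ)
  f ⊝ g = f ⊕ (⊖ g)

  data Span (P : (I → ℤ) → Set) : (I → ℤ) → Set where
    gen  : ∀ {f} → P f → Span P f
    zro  : Span P 𝟘
    add  : ∀ {f g} → Span P f → Span P g → Span P (f ⊕ g)
    neg  : ∀ {f} → Span P f → Span P (⊖ f)
    resp : ∀ {f g} → f ≈ g → Span P f → Span P g

sumℤ : List ℤ → ℤ
sumℤ = foldr _+_ 0ℤ

module GroupRing (G : FinAbGroup) (H : Subgroup G) where
  open FinAbGroup G public
  open Subgroup H public

  ZG : Set
  ZG = Fin n → ℤ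

  Σᴳ : (Fin n → ℤ) → ℤ
  Σᴳ f = foldr (λ x acc → f x + acc) 0ℤ (allFin n)

  δ : Fin n → ZG
  δ g x = if ⌊ g ≟ x ⌋ then 1ℤ else 0ℤ

  infixl 7 _⊛_
  _⊛_ : ZG → ZG → ZG
  (f ⊛ k) x = Σᴳ (λ y → f y * k ((y ⁻¹) ∙ x))

  InZH : ZG → Set
  InZH f = ∀ x → isH x ≡ false → f x ≡ 0ℤ

  InA : ZG → Set
  InA f = InZH f × Σᴳ f ≡ 0ℤ

  Apow : ℕ → ZG → Set
  Apow zero    f = InZH f
  Apow (suc t) f = Span (λ x → ∃[ a ] ∃[ b ] (InA a × Apow t b × x ≈ (a ⊛ b))) f

  InJ : ZG → Set
  InJ = Span (λ x → ∃[ r ] ∃[ a ] (InA a × x ≈ (r ⊛ a)))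

  Jpow : ℕ → ZG → Set
  Jpow zero    f = ⊤
  Jpow (suc t) f = Span (λ x → ∃[ j ] ∃[ b ] (InJ j × Jpow t b × x ≈ (j ⊛ b))) f

  -- Z[G] ⊗_Z Z[G] ≅ Z[G × G]; Z[G] ⊗ Z[H] sits inside it
  Tens : Set
  Tens = Fin n × Fin n → ℤ

  infixl 8 _⊗_
  _⊗_ : ZG → ZG → Tens
  (r ⊗ s) (x , y) = r x * s y

  infixl 7 _⋆_
  _⋆_ : Tens → Tens → Tens
  (T ⋆ S) (x , y) = Σᴳ (λ a → Σᴳ (λ b → T (a , b) * S ((a ⁻¹) ∙ x , (b ⁻¹) ∙ y)))

  infixr 7 _·_
  _·_ : ZG → Tens → Tens
  r · T = (r ⊗ δ e) ⋆ T

  TensA : ℕ → Tens → Set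
  TensA t = Span (λ X → ∃[ r ] ∃[ α ] (Apow t α × X ≈ (r ⊗ α)))

  ΣᴴT : (Fin n → Tens) → Tens
  ΣᴴT F = foldr (λ h acc → (if isH h then F h else 𝟘) ⊕ acc) 𝟘 (allFin n)

  ψ : ZG → Tens
  ψ ρ = ΣᴴT (λ h → (δ h ⊛ ρ) ⊗ δ (h ⁻¹))

  -- ι(γ) for γ = gH: Σ_{x ∈ G, xH = gH} x
  ι : Fin n → ZG
  ι g x = if isH ((g ⁻¹) ∙ x) then 1ℤ else 0ℤ

  Lemma5p6 : Set
  Lemma5p6 =
    ( (∀ ρ σ → ψ (ρ ⊕ σ) ≈ (ψ ρ ⊕ ψ σ))
    × (∀ r ρ → ψ (r ⊛ ρ) ≈ (r · ψ ρ))
    × (∀ ρ σ → ψ ρ ≈ ψ σ → ρ ≈ σ) )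
    × (∀ h → isH h ≡ true → ∀ ρ → ψ (δ h ⊛ ρ) ≈ (ψ ρ ⋆ (δ e ⊗ δ h)))
    × (∀ t ρ → Jpow t ρ → TensA t (ψ ρ))
    -- (iv) the induced map J^t/J^{t+1} → Z[G] ⊗ A^t/A^{t+1} is injective ...
    × ( (∀ t ρ → Jpow t ρ → TensA (suc t) (ψ ρ) → Jpow (suc t) ρ)
    -- ... and its composite with γ ⊗ α ↦ α γ̄ equals ι ⊗ 1
    --     (checked on the generators γ ⊗ ᾱ, γ = gH, α ∈ A^t, modulo Z[G] ⊗ A^{t+1})
      × (∀ t g α → Apow t α → TensA (suc t) (ψ (α ⊛ δ g) ⊝ (ι g ⊗ α))) )

module Submission where

-- Identify Z[G] ⊗ Z[G] with Z[G × G]. The key observation (ψ-eval) is that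
-- row x of ψ(ρ) is the slice y ↦ ρ(yx), y ∈ H, of ρ: the part of ρ on the
-- coset Hx moved into Z[H]. Every claim becomes a statement about slices:
--  (i)   slices are additive, the G-action permutes them (slice-⊛), and the
--        slice at x evaluated at e is ρ(x), which gives injectivity;
--  (ii)  multiplying by h ∈ H shifts every slice by h (slice-δ⊛);
--  (iii) slices are Z[H]-linear, so the slices of J^t lie in A^t;
--  (iv)  ρ is the sum over coset representatives x of (slice at x)·x, so ρ
--        lies in J^{t+1} once all its slices lie in A^{t+1} ⊂ J^{t+1}; and for
--        α ∈ A^t the rows of ψ(αg) - ι(gH) ⊗ α are (k⁻¹ - 1)α ∈ A^{t+1} or 0.
-- The file first develops finite integer sums (on top of the library's
-- sums over Fin), ℤ-spans and additive maps, and the group laws; the module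
-- Lemma5p6Proof then treats convolution, slices and the four parts in turn.

open import Defs
open import Data.Nat using (zero; suc)
open import Data.Fin using (Fin; zero; suc; _≟_; punchIn)
open import Data.Fin.Properties using (punchInᵢ≢i)
open import Data.Fin.Permutation using (Permutation; permutation)
open import Data.Integer using (ℤ; 0ℤ; 1ℤ; -1ℤ; _+_; _*_; -_; +_; -[1+_])
open import Data.Integer.Properties
  using (+-0-commutativeMonoid; +-*-semiring; +-identityʳ; +-identityˡ; *-identityˡ; *-identityʳ; *-zeroʳ;
         *-zeroˡ; *-comm; *-assoc; *-distribʳ-+; -1*i≡-i; neg-distribˡ-*)
open import Data.Integer.Tactic.RingSolver using (solve-∀)
open import Algebra.Properties.CommutativeMonoid.Sum +-0-commutativeMonoid
  using (sum; sum-cong-≗; sum-replicate-zero; sum-remove; ∑-distrib-+; ∑-comm; ∑-permute)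
open import Algebra.Properties.Semiring.Sum +-*-semiring using (*-distribˡ-sum; *-distribʳ-sum)
open import Data.List using (List; []; _∷_; foldr; allFin; tabulate)
open import Data.Bool using (Bool; true; false; if_then_else_; not; _∧_)
open import Data.Product using (_×_; _,_; ∃-syntax; proj₁)
open import Relation.Nullary using (¬_; yes; no)
open import Relation.Nullary.Decidable using (⌊_⌋)
open import Relation.Binary.PropositionalEquality
  using (_≡_; refl; sym; trans; cong; cong₂; _≗_; isEquivalence; module ≡-Reasoning)
open import Function using (_∘_; id)
open import Data.Empty using (⊥-elim)
open import Level using (0ℓ)
open import Algebra.Bundles using (AbelianGroup)
import Algebra.Properties.Group as GroupProperties
open import Algebra.Consequences.Propositional using (comm∧idˡ⇒id; comm∧invˡ⇒inv)
open import Data.Unit using (tt)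

foldr-tabulate : ∀ {m k} (g : Fin m → Fin k) (f : Fin k → ℤ) →
  foldr (λ x acc → f x + acc) 0ℤ (tabulate g) ≡ sum (f ∘ g)
foldr-tabulate {zero}  g f = refl
foldr-tabulate {suc m} g f = cong (λ s → f (g zero) + s) (foldr-tabulate (g ∘ suc) f)

sum-zero : ∀ {m} {f : Fin m → ℤ} → (∀ i → f i ≡ 0ℤ) → sum f ≡ 0ℤ
sum-zero {m} f≡0 = trans (sum-cong-≗ f≡0) (sum-replicate-zero m)

sum-neg : ∀ {m} (f : Fin m → ℤ) → sum (λ i → - f i) ≡ - sum f
sum-neg f = begin
  sum (λ i → - f i)      ≡⟨ sum-cong-≗ (λ i → sym (-1*i≡-i (f i))) ⟩
  sum (λ i → -1ℤ * f i)  ≡⟨ sym (*-distribˡ-sum -1ℤ f) ⟩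
  -1ℤ * sum f            ≡⟨ -1*i≡-i (sum f) ⟩
  - sum f                ∎
  where open ≡-Reasoning

-- The Kronecker delta on Fin m (GroupRing.δ is this function for m = n).
kron : ∀ {m} → Fin m → Fin m → ℤ
kron a b = if ⌊ a ≟ b ⌋ then 1ℤ else 0ℤ

kron-refl : ∀ {m} (a : Fin m) → kron a a ≡ 1ℤ
kron-refl a with a ≟ a
... | yes _  = refl
... | no a≢a = ⊥-elim (a≢a refl)

kron-≢ : ∀ {m} {a b : Fin m} → ¬ a ≡ b → kron a b ≡ 0ℤ
kron-≢ {a = a} {b} a≢b with a ≟ b
... | yes a≡b = ⊥-elim (a≢b a≡b)
... | no _    = refl

kron-cong : ∀ {m k} {a b : Fin m} {c d : Fin k} →
  (a ≡ b → c ≡ d) → (c ≡ d → a ≡ b) → kron a b ≡ kron c d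
kron-cong {a = a} {b} {c} {d} to from with a ≟ b
... | yes a≡b = sym (kron-≡ (to a≡b))
  where kron-≡ : c ≡ d → kron c d ≡ 1ℤ
        kron-≡ refl = kron-refl c
... | no a≢b = sym (kron-≢ (a≢b ∘ from))

kron-sym : ∀ {m} (a b : Fin m) → kron a b ≡ kron b a
kron-sym a b = kron-cong sym sym

sum-kron : ∀ {m} (a : Fin m) (F : Fin m → ℤ) → sum (λ b → kron a b * F b) ≡ F a
sum-kron {suc m} a F = begin
  sum t                       ≡⟨ sum-remove {i = a} t ⟩
  t a + sum (t ∘ punchIn a)   ≡⟨ cong₂ _+_ (cong (_* F a) (kron-refl a)) (sum-zero off-diagonal) ⟩
  1ℤ * F a + 0ℤ               ≡⟨ +-identityʳ _ ⟩
  1ℤ * F a                    ≡⟨ *-identityˡ (F a) ⟩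
  F a                         ∎
  where
  open ≡-Reasoning
  t : Fin (suc m) → ℤ
  t b = kron a b * F b
  off-diagonal : ∀ j → t (punchIn a j) ≡ 0ℤ
  off-diagonal j = trans (cong (_* F (punchIn a j)) (kron-≢ (punchInᵢ≢i a j ∘ sym))) (*-zeroˡ (F (punchIn a j)))

-- `first P x` holds iff x is the least element of Fin m satisfying P.
first : ∀ {m} → (Fin m → Bool) → Fin m → Bool
first P zero    = P zero
first P (suc x) = not (P zero) ∧ first (P ∘ suc) x

first⇒ : ∀ {m} (P : Fin m → Bool) x → first P x ≡ true → P x ≡ true
first⇒ P zero    Px = Px
first⇒ P (suc x) fx with P zero
... | false = first⇒ (P ∘ suc) x fx

first-cong : ∀ {m} {P Q : Fin m → Bool} → P ≗ Q → first P ≗ first Q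
first-cong P≗Q zero    = P≗Q zero
first-cong P≗Q (suc x) = cong₂ (λ b c → not b ∧ c) (P≗Q zero) (first-cong (P≗Q ∘ suc) x)

-- If P is satisfiable, exactly one x is first, so this sum picks c once.
sum-first : ∀ {m} (P : Fin m → Bool) {z} → P z ≡ true → ∀ c →
  sum (λ x → if first P x then c else 0ℤ) ≡ c
sum-first {suc m} P {z} Pz c with P zero in P0 | z
... | true  | _      = trans (cong (λ s → c + s) (sum-zero {m} (λ _ → refl))) (+-identityʳ c)
... | false | suc z' = trans (+-identityˡ _) (sum-first (P ∘ suc) Pz c)
... | false | zero   with () ← trans (sym Pz) P0

record IsAdditive {I J : Set} (F : (I → ℤ) → (J → ℤ)) : Set where
  field
    pres-𝟘 : F 𝟘 ≈ 𝟘
    pres-⊕ : ∀ f g → F (f ⊕ g) ≈ (F f ⊕ F g)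
    pres-⊖ : ∀ f → F (⊖ f) ≈ (⊖ F f)
    pres-≈ : ∀ {f g} → f ≈ g → F f ≈ F g

additive-∘ : ∀ {I J K : Set} {F : (J → ℤ) → (K → ℤ)} {G : (I → ℤ) → (J → ℤ)} →
  IsAdditive F → IsAdditive G → IsAdditive (F ∘ G)
additive-∘ {F = F} {G} addF addG = record
  { pres-𝟘 = λ k → trans (F.pres-≈ G.pres-𝟘 k) (F.pres-𝟘 k)
  ; pres-⊕ = λ f g k → trans (F.pres-≈ (G.pres-⊕ f g) k) (F.pres-⊕ (G f) (G g) k)
  ; pres-⊖ = λ f k → trans (F.pres-≈ (G.pres-⊖ f) k) (F.pres-⊖ (G f) k)
  ; pres-≈ = F.pres-≈ ∘ G.pres-≈
  }
  where module F = IsAdditive addF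
        module G = IsAdditive addG

span-map : ∀ {I J : Set} {P : (I → ℤ) → Set} {Q : (J → ℤ) → Set} {F : (I → ℤ) → (J → ℤ)} →
  IsAdditive F → (∀ f → P f → Span Q (F f)) → ∀ {f} → Span P f → Span Q (F f)
span-map addF onGen (gen p)    = onGen _ p
span-map addF onGen zro        = resp (λ i → sym (IsAdditive.pres-𝟘 addF i)) zro
span-map addF onGen (add s t)  =
  resp (λ i → sym (IsAdditive.pres-⊕ addF _ _ i)) (add (span-map addF onGen s) (span-map addF onGen t))
span-map addF onGen (neg s)    = resp (λ i → sym (IsAdditive.pres-⊖ addF _ i)) (neg (span-map addF onGen s))
span-map addF onGen (resp f≈g s) = resp (IsAdditive.pres-≈ addF f≈g) (span-map addF onGen s)

select : ∀ {I J : Set} → (J → Bool) → (J → I) → (I → ℤ) → (J → ℤ)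
select c σ f j = if c j then f (σ j) else 0ℤ

module _ {I J : Set} (c : J → Bool) (σ : J → I) where

  private
    select-𝟘 : select c σ 𝟘 ≈ 𝟘
    select-𝟘 j with c j
    ... | true  = refl
    ... | false = refl

    select-⊕ : ∀ f g → select c σ (f ⊕ g) ≈ (select c σ f ⊕ select c σ g)
    select-⊕ f g j with c j
    ... | true  = refl
    ... | false = refl

    select-⊖ : ∀ f → select c σ (⊖ f) ≈ (⊖ select c σ f)
    select-⊖ f j with c j
    ... | true  = refl
    ... | false = refl

    select-≈ : ∀ {f g} → f ≈ g → select c σ f ≈ select c σ g
    select-≈ f≈g j with c j
    ... | true  = f≈g (σ j)
    ... | false = refl

  select-additive : IsAdditive (select c σ)
  select-additive = record
    { pres-𝟘 = select-𝟘 ; pres-⊕ = select-⊕ ; pres-⊖ = select-⊖ ; pres-≈ = select-≈ }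

span-mono : ∀ {I : Set} {P Q : (I → ℤ) → Set} → (∀ {f} → P f → Q f) → ∀ {f} → Span P f → Span Q f
span-mono P⊂Q (gen p)      = gen (P⊂Q p)
span-mono P⊂Q zro          = zro
span-mono P⊂Q (add s t)    = add (span-mono P⊂Q s) (span-mono P⊂Q t)
span-mono P⊂Q (neg s)      = neg (span-mono P⊂Q s)
span-mono P⊂Q (resp f≈g s) = resp f≈g (span-mono P⊂Q s)

module _ {I : Set} {Q : (I → ℤ) → Set} where

  span-scaleℕ : ∀ k {f} → Span Q f → Span Q (λ i → + k * f i)
  span-scaleℕ zero    {f} s = resp (λ i → sym (*-zeroˡ (f i))) zro
  span-scaleℕ (suc k) {f} s = resp (λ i → sym (unfold (f i))) (add s (span-scaleℕ k s))
    where unfold : ∀ a → + suc k * a ≡ a + + k * a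
          unfold a = trans (*-distribʳ-+ a (+ 1) (+ k)) (cong (λ b → b + + k * a) (*-identityˡ a))

  span-scale : ∀ c {f} → Span Q f → Span Q (λ i → c * f i)
  span-scale (+ k)      s = span-scaleℕ k s
  span-scale -[1+ k ] {f} s = resp (λ i → neg-distribˡ-* (+ suc k) (f i)) (neg (span-scaleℕ (suc k) s))

  span-sum : ∀ {m} (F : Fin m → I → ℤ) → (∀ x → Span Q (F x)) → Span Q (λ i → sum (λ x → F x i))
  span-sum {zero}  F s = zro
  span-sum {suc m} F s = add (s zero) (span-sum (F ∘ suc) (s ∘ suc))

  span-if : ∀ b {f} → Span Q f → Span Q (λ i → if b then f i else 0ℤ)
  span-if true  s = s
  span-if false s = zro

-- Group laws: a FinAbGroup is a library abelian group, so the derived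
-- laws of Algebra.Properties.Group apply to it.

module GroupLaws (G : FinAbGroup) where
  open FinAbGroup G

  abelianGroup : AbelianGroup 0ℓ 0ℓ
  abelianGroup = record
    { Carrier = Fin n ; _≈_ = _≡_ ; _∙_ = _∙_ ; ε = e ; _⁻¹ = _⁻¹
    ; isAbelianGroup = record
      { isGroup = record
        { isMonoid = record
          { isSemigroup = record
            { isMagma = record { isEquivalence = isEquivalence ; ∙-cong = cong₂ _∙_ }
            ; assoc = assoc }
          ; identity = comm∧idˡ⇒id comm identityˡ }
        ; inverse = comm∧invˡ⇒inv comm inverseˡ
        ; ⁻¹-cong = cong _⁻¹ }
      ; comm = comm } }

  open GroupProperties (AbelianGroup.group abelianGroup) public
    using (\\-leftDividesˡ; \\-leftDividesʳ; //-rightDividesˡ; x≈z//y; y≈x\\z;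
           ⁻¹-involutive; ε⁻¹≈ε; ⁻¹-anti-homo-∙)

  identityʳ : ∀ x → x ∙ e ≡ x
  identityʳ = AbelianGroup.identityʳ abelianGroup

  inverseʳ : ∀ x → x ∙ (x ⁻¹) ≡ e
  inverseʳ = AbelianGroup.inverseʳ abelianGroup

  e⁻¹∙ : ∀ y → (e ⁻¹) ∙ y ≡ y
  e⁻¹∙ y = trans (cong (_∙ y) ε⁻¹≈ε) (identityˡ y)

  ∙e⁻¹ : ∀ x → x ∙ (e ⁻¹) ≡ x
  ∙e⁻¹ x = trans (cong (x ∙_) ε⁻¹≈ε) (identityʳ x)

  swapˡ : ∀ a y x → a ∙ (y ∙ x) ≡ y ∙ (a ∙ x)
  swapˡ a y x = trans (sym (assoc a y x)) (trans (cong (_∙ x) (comm a y)) (assoc y a x))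

  translation : Fin n → Permutation n n
  translation u = permutation (u ∙_) ((u ⁻¹) ∙_) (\\-leftDividesˡ u) (\\-leftDividesʳ u)

module SubgroupLaws (G : FinAbGroup) (H : Subgroup G) where
  open FinAbGroup G
  open Subgroup H
  open GroupLaws G

  isH-mulˡ : ∀ h y → isH h ≡ true → isH (h ∙ y) ≡ isH y
  isH-mulˡ h y h∈H with isH y in y∈? | isH (h ∙ y) in hy∈?
  ... | true  | true  = refl
  ... | true  | false = trans (sym hy∈?) (∙∈ h y h∈H y∈?)
  ... | false | false = refl
  ... | false | true  = trans (sym (∙∈ (h ⁻¹) (h ∙ y) (⁻¹∈ h h∈H) hy∈?))
                              (trans (cong isH (\\-leftDividesʳ h y)) y∈?)

  isH-mulʳ : ∀ h y → isH h ≡ true → isH (y ∙ h) ≡ isH y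
  isH-mulʳ h y h∈H = trans (cong isH (comm y h)) (isH-mulˡ h y h∈H)

  isH-inv : ∀ x → isH (x ⁻¹) ≡ isH x
  isH-inv x with isH x in x∈? | isH (x ⁻¹) in x⁻¹∈?
  ... | true  | true  = refl
  ... | true  | false = trans (sym x⁻¹∈?) (⁻¹∈ x x∈?)
  ... | false | false = refl
  ... | false | true  = trans (sym (⁻¹∈ (x ⁻¹) x⁻¹∈?)) (trans (cong isH (⁻¹-involutive x)) x∈?)

module Lemma5p6Proof (G : FinAbGroup) (H : Subgroup G) where
  open GroupRing G H
  open GroupLaws G
  open SubgroupLaws G H
  open ≡-Reasoning

  Σᴳ≡sum : ∀ f → Σᴳ f ≡ sum f
  Σᴳ≡sum = foldr-tabulate id

  conv-eval : ∀ f r z → (f ⊛ r) z ≡ sum (λ y → f y * r ((y ⁻¹) ∙ z))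
  conv-eval f r z = Σᴳ≡sum _

  δ⊛ : ∀ h ρ x → (δ h ⊛ ρ) x ≡ ρ ((h ⁻¹) ∙ x)
  δ⊛ h ρ x = trans (conv-eval (δ h) ρ x) (sum-kron h (λ u → ρ ((u ⁻¹) ∙ x)))

  δ-solve : ∀ g u z → δ g ((u ⁻¹) ∙ z) ≡ kron (z ∙ (g ⁻¹)) u
  δ-solve g u z = kron-cong
    (λ g≡u⁻¹z → sym (x≈z//y u g z (trans (cong (u ∙_) g≡u⁻¹z) (\\-leftDividesˡ u z))))
    (λ zg⁻¹≡u → y≈x\\z u g z (trans (cong (_∙ g) (sym zg⁻¹≡u)) (//-rightDividesˡ g z)))

  ⊛δ : ∀ ρ g z → (ρ ⊛ δ g) z ≡ ρ (z ∙ (g ⁻¹))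
  ⊛δ ρ g z = begin
    (ρ ⊛ δ g) z                            ≡⟨ conv-eval ρ (δ g) z ⟩
    sum (λ u → ρ u * δ g ((u ⁻¹) ∙ z))     ≡⟨ sum-cong-≗ {n} (λ u → trans (cong (ρ u *_) (δ-solve g u z))
                                                                     (*-comm (ρ u) _)) ⟩
    sum (λ u → kron (z ∙ (g ⁻¹)) u * ρ u)  ≡⟨ sum-kron (z ∙ (g ⁻¹)) ρ ⟩
    ρ (z ∙ (g ⁻¹))                         ∎

  δe⊛ : ∀ a → (δ e ⊛ a) ≈ a
  δe⊛ a z = trans (δ⊛ e a z) (cong a (e⁻¹∙ z))

  ⊛ʳ-additive : ∀ r → IsAdditive (_⊛ r)
  ⊛ʳ-additive r = record
    { pres-𝟘 = λ z → trans (conv-eval 𝟘 r z) (sum-zero {n} (λ y → *-zeroˡ (r ((y ⁻¹) ∙ z))))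
    ; pres-⊕ = λ f g z → begin
        ((f ⊕ g) ⊛ r) z                                    ≡⟨ conv-eval (f ⊕ g) r z ⟩
        sum (λ y → (f y + g y) * r ((y ⁻¹) ∙ z))           ≡⟨ sum-cong-≗ {n} (λ y → *-distribʳ-+ _ (f y) (g y)) ⟩
        sum (λ y → f y * r ((y ⁻¹) ∙ z) + g y * r ((y ⁻¹) ∙ z))
                                                           ≡⟨ ∑-distrib-+ {n} _ _ ⟩
        sum (λ y → f y * r ((y ⁻¹) ∙ z)) + sum (λ y → g y * r ((y ⁻¹) ∙ z))
                                                           ≡⟨ sym (cong₂ _+_ (conv-eval f r z) (conv-eval g r z)) ⟩
        ((f ⊛ r) ⊕ (g ⊛ r)) z                              ∎
    ; pres-⊖ = λ f z → begin
        ((⊖ f) ⊛ r) z                                      ≡⟨ conv-eval (⊖ f) r z ⟩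
        sum (λ y → - f y * r ((y ⁻¹) ∙ z))                 ≡⟨ sum-cong-≗ {n} (λ y → sym (neg-distribˡ-* (f y) _)) ⟩
        sum (λ y → - (f y * r ((y ⁻¹) ∙ z)))               ≡⟨ sum-neg {n} _ ⟩
        - sum (λ y → f y * r ((y ⁻¹) ∙ z))                 ≡⟨ cong -_ (sym (conv-eval f r z)) ⟩
        (⊖ (f ⊛ r)) z                                      ∎
    ; pres-≈ = λ {f} {g} f≈g z → begin
        (f ⊛ r) z                                          ≡⟨ conv-eval f r z ⟩
        sum (λ y → f y * r ((y ⁻¹) ∙ z))                   ≡⟨ sum-cong-≗ {n} (λ y → cong (_* r ((y ⁻¹) ∙ z)) (f≈g y)) ⟩
        sum (λ y → g y * r ((y ⁻¹) ∙ z))                   ≡⟨ sym (conv-eval g r z) ⟩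
        (g ⊛ r) z                                          ∎
    }

  -- (u a) ⊛ b = u (a ⊛ b): reindex the convolution along v = u w.
  translate-⊛ : ∀ u a b z →
    sum (λ v → a ((u ⁻¹) ∙ v) * b ((v ⁻¹) ∙ z)) ≡ (a ⊛ b) ((u ⁻¹) ∙ z)
  translate-⊛ u a b z = begin
    sum (λ v → a ((u ⁻¹) ∙ v) * b ((v ⁻¹) ∙ z))              ≡⟨ ∑-permute {n} {n} _ (translation u) ⟩
    sum (λ w → a ((u ⁻¹) ∙ (u ∙ w)) * b (((u ∙ w) ⁻¹) ∙ z))  ≡⟨ sum-cong-≗ {n} (λ w →
                                                                   cong₂ (λ p q → a p * b q)
                                                                     (\\-leftDividesʳ u w) (reassociate w)) ⟩
    sum (λ w → a w * b ((w ⁻¹) ∙ ((u ⁻¹) ∙ z)))              ≡⟨ sym (conv-eval a b _) ⟩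
    (a ⊛ b) ((u ⁻¹) ∙ z)                                     ∎
    where
    reassociate : ∀ w → ((u ∙ w) ⁻¹) ∙ z ≡ (w ⁻¹) ∙ ((u ⁻¹) ∙ z)
    reassociate w = trans (cong (_∙ z) (⁻¹-anti-homo-∙ u w)) (assoc (w ⁻¹) (u ⁻¹) z)

  ⊛-assoc : ∀ r a b → ((r ⊛ a) ⊛ b) ≈ (r ⊛ (a ⊛ b))
  ⊛-assoc r a b z = begin
    ((r ⊛ a) ⊛ b) z
      ≡⟨ conv-eval (r ⊛ a) b z ⟩
    sum (λ v → (r ⊛ a) v * b ((v ⁻¹) ∙ z))
      ≡⟨ sum-cong-≗ {n} (λ v → trans (cong (_* b ((v ⁻¹) ∙ z)) (conv-eval r a v))
                                 (*-distribʳ-sum {n} (b ((v ⁻¹) ∙ z)) _)) ⟩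
    sum (λ v → sum (λ u → r u * a ((u ⁻¹) ∙ v) * b ((v ⁻¹) ∙ z)))
      ≡⟨ ∑-comm {n} {n} (λ v u → r u * a ((u ⁻¹) ∙ v) * b ((v ⁻¹) ∙ z)) ⟩
    sum (λ u → sum (λ v → r u * a ((u ⁻¹) ∙ v) * b ((v ⁻¹) ∙ z)))
      ≡⟨ sum-cong-≗ {n} (λ u → trans (sum-cong-≗ {n} (λ v → *-assoc (r u) _ _))
                                 (sym (*-distribˡ-sum {n} (r u) _))) ⟩
    sum (λ u → r u * sum (λ v → a ((u ⁻¹) ∙ v) * b ((v ⁻¹) ∙ z)))
      ≡⟨ sum-cong-≗ {n} (λ u → cong (r u *_) (translate-⊛ u a b z)) ⟩
    sum (λ u → r u * (a ⊛ b) ((u ⁻¹) ∙ z))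
      ≡⟨ sym (conv-eval r (a ⊛ b) z) ⟩
    (r ⊛ (a ⊛ b)) z ∎

  span⊂ZH : ∀ {P : ZG → Set} → (∀ {f} → P f → InZH f) → ∀ {f} → Span P f → InZH f
  span⊂ZH P⊂ZH (gen p)        y y∉H = P⊂ZH p y y∉H
  span⊂ZH P⊂ZH zro            y y∉H = refl
  span⊂ZH P⊂ZH (add s t)      y y∉H = cong₂ _+_ (span⊂ZH P⊂ZH s y y∉H) (span⊂ZH P⊂ZH t y y∉H)
  span⊂ZH P⊂ZH (neg s)        y y∉H = cong -_ (span⊂ZH P⊂ZH s y y∉H)
  span⊂ZH P⊂ZH (resp f≈g s)   y y∉H = trans (sym (f≈g y)) (span⊂ZH P⊂ZH s y y∉H)

  ZH-⊛ : ∀ {a b} → InZH a → InZH b → InZH (a ⊛ b)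
  ZH-⊛ {a} {b} a∈ b∈ y y∉H = trans (conv-eval a b y) (sum-zero {n} term)
    where
    term : ∀ u → a u * b ((u ⁻¹) ∙ y) ≡ 0ℤ
    term u with isH u in u∈?
    ... | false = trans (cong (_* b ((u ⁻¹) ∙ y)) (a∈ u u∈?)) (*-zeroˡ (b ((u ⁻¹) ∙ y)))
    ... | true  = trans (cong (a u *_) (b∈ _ (trans (isH-mulˡ (u ⁻¹) y (⁻¹∈ u u∈?)) y∉H))) (*-zeroʳ (a u))

  Apow⊂ZH : ∀ t {α} → Apow t α → InZH α
  Apow⊂ZH zero    α∈ = α∈
  Apow⊂ZH (suc t) α∈ = span⊂ZH (λ { (a , b , a∈A , b∈ , f≈ab) y y∉H →
                                     trans (f≈ab y) (ZH-⊛ (proj₁ a∈A) (Apow⊂ZH t b∈) y y∉H) }) α∈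

  sum-δ : ∀ a → sum (δ a) ≡ 1ℤ
  sum-δ a = trans (sum-cong-≗ {n} (λ b → sym (*-identityʳ (δ a b)))) (sum-kron a (λ _ → 1ℤ))

  translate-diff∈A : ∀ {h} → isH h ≡ true → InA (δ h ⊝ δ e)
  translate-diff∈A {h} h∈H = in-ZH , augmentation
    where
    in-ZH : InZH (δ h ⊝ δ e)
    in-ZH y y∉H = cong₂ (λ u v → u + - v) (kron-≢ (outside h∈H)) (kron-≢ (outside e∈))
      where outside : ∀ {u} → isH u ≡ true → ¬ u ≡ y
            outside u∈H refl with () ← trans (sym u∈H) y∉H
    augmentation : Σᴳ (δ h ⊝ δ e) ≡ 0ℤ
    augmentation = begin
      Σᴳ (δ h ⊝ δ e)                   ≡⟨ Σᴳ≡sum (δ h ⊝ δ e) ⟩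
      sum (λ y → δ h y + - δ e y)      ≡⟨ ∑-distrib-+ {n} (δ h) (λ y → - δ e y) ⟩
      sum (δ h) + sum (λ y → - δ e y)  ≡⟨ cong₂ _+_ (sum-δ h) (trans (sum-neg (δ e)) (cong -_ (sum-δ e))) ⟩
      1ℤ + - 1ℤ                        ≡⟨⟩
      0ℤ                               ∎

  -- Slices. The slice of ρ at x is y ↦ ρ (y x) on H: the part of ρ on
  -- the coset Hx, moved into Z[H]. They are the rows of ψ(ρ) (ψ-eval).

  slice : Fin n → ZG → ZG
  slice x = select isH (_∙ x)

  slice-additive : ∀ x → IsAdditive (slice x)
  slice-additive x = select-additive isH (_∙ x)

  slice∈ZH : ∀ x ρ → InZH (slice x ρ)
  slice∈ZH x ρ y y∉H rewrite y∉H = refl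

  slice-e : ∀ x ρ → slice x ρ e ≡ ρ x
  slice-e x ρ rewrite e∈ = cong ρ (identityˡ x)

  slice-⊛ : ∀ x r ρ y → slice x (r ⊛ ρ) y ≡ sum (λ a → r a * slice ((a ⁻¹) ∙ x) ρ y)
  slice-⊛ x r ρ y with isH y
  ... | true  = trans (conv-eval r ρ (y ∙ x)) (sum-cong-≗ {n} (λ a → cong (λ u → r a * ρ u) (swapˡ (a ⁻¹) y x)))
  ... | false = sym (sum-zero {n} (λ a → *-zeroʳ (r a)))

  slice-⊛δ : ∀ x ρ g → slice x (ρ ⊛ δ g) ≈ slice (x ∙ (g ⁻¹)) ρ
  slice-⊛δ x ρ g y with isH y
  ... | true  = trans (⊛δ ρ g (y ∙ x)) (cong ρ (assoc y x (g ⁻¹)))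
  ... | false = refl

  slice-δ⊛ : ∀ {h} → isH h ≡ true → ∀ x ρ y → slice x (δ h ⊛ ρ) y ≡ slice x ρ (y ∙ (h ⁻¹))
  slice-δ⊛ {h} h∈H x ρ y rewrite isH-mulʳ (h ⁻¹) y (⁻¹∈ h h∈H) with isH y
  ... | true  = trans (δ⊛ h ρ (y ∙ x)) (cong ρ (trans (swapˡ (h ⁻¹) y x) (sym (assoc y (h ⁻¹) x))))
  ... | false = refl

  slice-ZH-linear : ∀ {a} b w → InZH a → (a ⊛ slice w b) ≈ slice w (a ⊛ b)
  slice-ZH-linear {a} b w a∈ y with isH y in y∈?
  ... | true  = trans (conv-eval a (slice w b) y) (trans (sum-cong-≗ {n} term) (sym (conv-eval a b (y ∙ w))))
    where
    term : ∀ u → a u * slice w b ((u ⁻¹) ∙ y) ≡ a u * b ((u ⁻¹) ∙ (y ∙ w))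
    term u with isH u in u∈?
    ... | false = trans (cong (_* slice w b ((u ⁻¹) ∙ y)) (a∈ u u∈?))
                        (trans (*-zeroˡ (slice w b ((u ⁻¹) ∙ y)))
                          (sym (trans (cong (_* b ((u ⁻¹) ∙ (y ∙ w))) (a∈ u u∈?)) (*-zeroˡ (b ((u ⁻¹) ∙ (y ∙ w)))))))
    ... | true rewrite isH-mulˡ (u ⁻¹) y (⁻¹∈ u u∈?) | y∈? = cong (λ z → a u * b z) (assoc (u ⁻¹) y w)
  ... | false = trans (conv-eval a (slice w b) y) (sum-zero {n} term)
    where
    term : ∀ u → a u * slice w b ((u ⁻¹) ∙ y) ≡ 0ℤ
    term u with isH u in u∈?
    ... | false = trans (cong (_* slice w b ((u ⁻¹) ∙ y)) (a∈ u u∈?)) (*-zeroˡ (slice w b ((u ⁻¹) ∙ y)))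
    ... | true rewrite isH-mulˡ (u ⁻¹) y (⁻¹∈ u u∈?) | y∈? = *-zeroʳ (a u)

  slice-ZH-inside : ∀ {α k} → InZH α → isH k ≡ true → slice k α ≈ (δ (k ⁻¹) ⊛ α)
  slice-ZH-inside {α} {k} α∈ k∈H y = begin
    slice k α y                       ≡⟨ on-H (isH y) refl ⟩
    α (k ∙ y)                         ≡⟨ cong (λ u → α (u ∙ y)) (sym (⁻¹-involutive k)) ⟩
    α (((k ⁻¹) ⁻¹) ∙ y)               ≡⟨ sym (δ⊛ (k ⁻¹) α y) ⟩
    (δ (k ⁻¹) ⊛ α) y                  ∎
    where
    on-H : ∀ b → isH y ≡ b → (if b then α (y ∙ k) else 0ℤ) ≡ α (k ∙ y)
    on-H true  _     = cong α (comm y k)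
    on-H false y∉H   = sym (α∈ (k ∙ y) (trans (isH-mulˡ k y k∈H) y∉H))

  slice-ZH-outside : ∀ {α k} → InZH α → isH k ≡ false → slice k α ≈ 𝟘
  slice-ZH-outside {α} {k} α∈ k∉H y with isH y in y∈?
  ... | true  = α∈ (y ∙ k) (trans (isH-mulˡ y k y∈?) k∉H)
  ... | false = refl

  ΣᴴT-list : ∀ (L : List (Fin n)) (F : Fin n → Tens) p →
    foldr (λ h acc → (if isH h then F h else 𝟘) ⊕ acc) 𝟘 L p
      ≡ foldr (λ h acc → (if isH h then F h p else 0ℤ) + acc) 0ℤ L
  ΣᴴT-list []      F p = refl
  ΣᴴT-list (h ∷ L) F p = cong₂ _+_ (if-apply (isH h)) (ΣᴴT-list L F p)
    where if-apply : ∀ b → (if b then F h else 𝟘) p ≡ (if b then F h p else 0ℤ)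
          if-apply true  = refl
          if-apply false = refl

  ΣᴴT-eval : ∀ (F : Fin n → Tens) p → ΣᴴT F p ≡ sum (λ h → if isH h then F h p else 0ℤ)
  ΣᴴT-eval F p = trans (ΣᴴT-list (allFin n) F p) (foldr-tabulate id (λ h → if isH h then F h p else 0ℤ))

  δ-inv : ∀ h y → δ (h ⁻¹) y ≡ kron (y ⁻¹) h
  δ-inv h y = kron-cong (λ h⁻¹≡y → trans (cong _⁻¹ (sym h⁻¹≡y)) (⁻¹-involutive h))
                        (λ y⁻¹≡h → trans (cong _⁻¹ (sym y⁻¹≡h)) (⁻¹-involutive y))

  ψ-eval : ∀ ρ x y → ψ ρ (x , y) ≡ slice x ρ y
  ψ-eval ρ x y = begin
    ψ ρ (x , y)
      ≡⟨ ΣᴴT-eval (λ h → (δ h ⊛ ρ) ⊗ δ (h ⁻¹)) (x , y) ⟩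
    sum (λ h → if isH h then (δ h ⊛ ρ) x * δ (h ⁻¹) y else 0ℤ)
      ≡⟨ sum-cong-≗ {n} term ⟩
    sum (λ h → kron (y ⁻¹) h * (if isH h then ρ ((h ⁻¹) ∙ x) else 0ℤ))
      ≡⟨ sum-kron (y ⁻¹) (λ h → if isH h then ρ ((h ⁻¹) ∙ x) else 0ℤ) ⟩
    (if isH (y ⁻¹) then ρ (((y ⁻¹) ⁻¹) ∙ x) else 0ℤ)
      ≡⟨ cong₂ (λ b u → if b then ρ (u ∙ x) else 0ℤ) (isH-inv y) (⁻¹-involutive y) ⟩
    slice x ρ y ∎
    where
    term : ∀ h → (if isH h then (δ h ⊛ ρ) x * δ (h ⁻¹) y else 0ℤ)
                   ≡ kron (y ⁻¹) h * (if isH h then ρ ((h ⁻¹) ∙ x) else 0ℤ)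
    term h with isH h
    ... | true  = trans (cong₂ _*_ (δ⊛ h ρ x) (δ-inv h y)) (*-comm (ρ ((h ⁻¹) ∙ x)) (kron (y ⁻¹) h))
    ... | false = sym (*-zeroʳ (kron (y ⁻¹) h))

  ⋆-eval : ∀ T S x y → (T ⋆ S) (x , y) ≡ sum (λ a → sum (λ b → T (a , b) * S ((a ⁻¹) ∙ x , (b ⁻¹) ∙ y)))
  ⋆-eval T S x y = trans (Σᴳ≡sum _) (sum-cong-≗ {n} (λ a → Σᴳ≡sum _))

  ·-eval : ∀ r T x y → (r · T) (x , y) ≡ sum (λ a → r a * T ((a ⁻¹) ∙ x , y))
  ·-eval r T x y = trans (⋆-eval (r ⊗ δ e) T x y) (sum-cong-≗ {n} inner)
    where
    rearrange : ∀ p q s → p * q * s ≡ q * (p * s)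
    rearrange = solve-∀
    inner : ∀ a → sum (λ b → r a * δ e b * T ((a ⁻¹) ∙ x , (b ⁻¹) ∙ y)) ≡ r a * T ((a ⁻¹) ∙ x , y)
    inner a = begin
      sum (λ b → r a * δ e b * T ((a ⁻¹) ∙ x , (b ⁻¹) ∙ y))
        ≡⟨ sum-cong-≗ {n} (λ b → rearrange (r a) (δ e b) _) ⟩
      sum (λ b → δ e b * (r a * T ((a ⁻¹) ∙ x , (b ⁻¹) ∙ y)))
        ≡⟨ sum-kron e (λ b → r a * T ((a ⁻¹) ∙ x , (b ⁻¹) ∙ y)) ⟩
      r a * T ((a ⁻¹) ∙ x , (e ⁻¹) ∙ y)
        ≡⟨ cong (λ u → r a * T ((a ⁻¹) ∙ x , u)) (e⁻¹∙ y) ⟩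
      r a * T ((a ⁻¹) ∙ x , y) ∎

  ⋆-basis : ∀ T c d x y → (T ⋆ (δ c ⊗ δ d)) (x , y) ≡ T (x ∙ (c ⁻¹) , y ∙ (d ⁻¹))
  ⋆-basis T c d x y = begin
    (T ⋆ (δ c ⊗ δ d)) (x , y)
      ≡⟨ ⋆-eval T (δ c ⊗ δ d) x y ⟩
    sum (λ a → sum (λ b → T (a , b) * (δ c ((a ⁻¹) ∙ x) * δ d ((b ⁻¹) ∙ y))))
      ≡⟨ sum-cong-≗ {n} inner ⟩
    sum (λ a → kron (x ∙ (c ⁻¹)) a * T (a , y ∙ (d ⁻¹)))
      ≡⟨ sum-kron (x ∙ (c ⁻¹)) (λ a → T (a , y ∙ (d ⁻¹))) ⟩
    T (x ∙ (c ⁻¹) , y ∙ (d ⁻¹)) ∎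
    where
    rearrange : ∀ t p q → t * (p * q) ≡ q * (p * t)
    rearrange = solve-∀
    inner : ∀ a → sum (λ b → T (a , b) * (δ c ((a ⁻¹) ∙ x) * δ d ((b ⁻¹) ∙ y)))
                    ≡ kron (x ∙ (c ⁻¹)) a * T (a , y ∙ (d ⁻¹))
    inner a = begin
      sum (λ b → T (a , b) * (δ c ((a ⁻¹) ∙ x) * δ d ((b ⁻¹) ∙ y)))
        ≡⟨ sum-cong-≗ {n} (λ b → trans (cong₂ (λ p q → T (a , b) * (p * q)) (δ-solve c a x) (δ-solve d b y))
                                       (rearrange (T (a , b)) (kron (x ∙ (c ⁻¹)) a) (kron (y ∙ (d ⁻¹)) b))) ⟩
      sum (λ b → kron (y ∙ (d ⁻¹)) b * (kron (x ∙ (c ⁻¹)) a * T (a , b)))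
        ≡⟨ sum-kron (y ∙ (d ⁻¹)) (λ b → kron (x ∙ (c ⁻¹)) a * T (a , b)) ⟩
      kron (x ∙ (c ⁻¹)) a * T (a , y ∙ (d ⁻¹)) ∎

  row : Tens → Fin n → ZG
  row T x y = T (x , y)

  -- A tensor all of whose rows lie in A^s lies in Z[G] ⊗ A^s,
  -- since T = Σ_x x ⊗ (row x of T).
  rows⇒TensA : ∀ s T (R : Fin n → ZG) → (∀ x y → T (x , y) ≡ R x y) → (∀ x → Apow s (R x)) → TensA s T
  rows⇒TensA s T R T≡R R∈ =
    resp expand (span-sum (λ x → δ x ⊗ R x) (λ x → gen (δ x , R x , R∈ x , λ _ → refl)))
    where
    expand : ∀ p → sum (λ x → (δ x ⊗ R x) p) ≡ T p
    expand (a , b) = begin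
      sum (λ x → δ x a * R x b)  ≡⟨ sum-cong-≗ {n} (λ x → cong (_* R x b) (kron-sym x a)) ⟩
      sum (λ x → δ a x * R x b)  ≡⟨ sum-kron a (λ x → R x b) ⟩
      R a b                      ≡⟨ sym (T≡R a b) ⟩
      T (a , b)                  ∎

  TensA⇒rows : ∀ t T → TensA (suc t) T → ∀ x → Apow (suc t) (row T x)
  TensA⇒rows t T T∈ x = span-map (select-additive (λ _ → true) (x ,_)) onGen T∈
    where
    onGen : ∀ X → (∃[ r ] ∃[ α ] (Apow (suc t) α × X ≈ (r ⊗ α))) → Apow (suc t) (row X x)
    onGen X (r , α , α∈ , X≈r⊗α) = resp (λ y → sym (X≈r⊗α (x , y))) (span-scale (r x) α∈)

  ψ-additive : ∀ ρ σ → ψ (ρ ⊕ σ) ≈ (ψ ρ ⊕ ψ σ)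
  ψ-additive ρ σ (x , y) = begin
    ψ (ρ ⊕ σ) (x , y)          ≡⟨ ψ-eval (ρ ⊕ σ) x y ⟩
    slice x (ρ ⊕ σ) y          ≡⟨ IsAdditive.pres-⊕ (slice-additive x) ρ σ y ⟩
    slice x ρ y + slice x σ y  ≡⟨ sym (cong₂ _+_ (ψ-eval ρ x y) (ψ-eval σ x y)) ⟩
    (ψ ρ ⊕ ψ σ) (x , y)        ∎

  ψ-linear : ∀ r ρ → ψ (r ⊛ ρ) ≈ (r · ψ ρ)
  ψ-linear r ρ (x , y) = begin
    ψ (r ⊛ ρ) (x , y)                               ≡⟨ ψ-eval (r ⊛ ρ) x y ⟩
    slice x (r ⊛ ρ) y                               ≡⟨ slice-⊛ x r ρ y ⟩
    sum (λ a → r a * slice ((a ⁻¹) ∙ x) ρ y)        ≡⟨ sum-cong-≗ {n} (λ a → cong (r a *_) (sym (ψ-eval ρ _ y))) ⟩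
    sum (λ a → r a * ψ ρ ((a ⁻¹) ∙ x , y))          ≡⟨ sym (·-eval r (ψ ρ) x y) ⟩
    (r · ψ ρ) (x , y)                               ∎

  -- ρ is recovered from ψ(ρ) as the coefficient of x ⊗ 1.
  ψ-injective : ∀ ρ σ → ψ ρ ≈ ψ σ → ρ ≈ σ
  ψ-injective ρ σ ψρ≈ψσ x = begin
    ρ x              ≡⟨ sym (slice-e x ρ) ⟩
    slice x ρ e      ≡⟨ sym (ψ-eval ρ x e) ⟩
    ψ ρ (x , e)      ≡⟨ ψρ≈ψσ (x , e) ⟩
    ψ σ (x , e)      ≡⟨ ψ-eval σ x e ⟩
    slice x σ e      ≡⟨ slice-e x σ ⟩
    σ x              ∎

  ψ-H-equivariant : ∀ h → isH h ≡ true → ∀ ρ → ψ (δ h ⊛ ρ) ≈ (ψ ρ ⋆ (δ e ⊗ δ h))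
  ψ-H-equivariant h h∈H ρ (x , y) = begin
    ψ (δ h ⊛ ρ) (x , y)                 ≡⟨ ψ-eval (δ h ⊛ ρ) x y ⟩
    slice x (δ h ⊛ ρ) y                 ≡⟨ slice-δ⊛ h∈H x ρ y ⟩
    slice x ρ (y ∙ (h ⁻¹))              ≡⟨ sym (ψ-eval ρ x (y ∙ (h ⁻¹))) ⟩
    ψ ρ (x , y ∙ (h ⁻¹))                ≡⟨ cong (λ u → ψ ρ (u , y ∙ (h ⁻¹))) (sym (∙e⁻¹ x)) ⟩
    ψ ρ (x ∙ (e ⁻¹) , y ∙ (h ⁻¹))       ≡⟨ sym (⋆-basis (ψ ρ) e h x y) ⟩
    (ψ ρ ⋆ (δ e ⊗ δ h)) (x , y)         ∎

  -- Part (iii): ψ(J^t) ⊂ Z[G] ⊗ A^t, because every slice of J^t lies in A^t.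

  -- If all slices of b lie in A^t and j ∈ J, all slices of j b lie in A^{t+1}:
  -- for j = r a with a ∈ A, the slices of r a b are Z-combinations of a · (slices of b).
  slices-of-product : ∀ t b → (∀ w → Apow t (slice w b)) → ∀ {j} → InJ j → ∀ x → Apow (suc t) (slice x (j ⊛ b))
  slices-of-product t b b-slices j∈J x = span-map (additive-∘ (slice-additive x) (⊛ʳ-additive b)) onGen j∈J
    where
    onGen : ∀ j → (∃[ r ] ∃[ a ] (InA a × j ≈ (r ⊛ a))) → Apow (suc t) (slice x (j ⊛ b))
    onGen j (r , a , a∈A , j≈ra) = resp (λ y → sym (expand y)) (span-sum _ λ u → span-scale (r u) (a-slice u))
      where
      a-slice : ∀ u → Apow (suc t) (slice ((u ⁻¹) ∙ x) (a ⊛ b))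
      a-slice u = resp (slice-ZH-linear b ((u ⁻¹) ∙ x) (proj₁ a∈A))
                       (gen (a , slice ((u ⁻¹) ∙ x) b , a∈A , b-slices ((u ⁻¹) ∙ x) , λ _ → refl))
      expand : ∀ y → slice x (j ⊛ b) y ≡ sum (λ u → r u * slice ((u ⁻¹) ∙ x) (a ⊛ b) y)
      expand y = begin
        slice x (j ⊛ b) y        ≡⟨ IsAdditive.pres-≈ (additive-∘ (slice-additive x) (⊛ʳ-additive b)) j≈ra y ⟩
        slice x ((r ⊛ a) ⊛ b) y  ≡⟨ IsAdditive.pres-≈ (slice-additive x) (⊛-assoc r a b) y ⟩
        slice x (r ⊛ (a ⊛ b)) y  ≡⟨ slice-⊛ x r (a ⊛ b) y ⟩
        sum (λ u → r u * slice ((u ⁻¹) ∙ x) (a ⊛ b) y) ∎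

  slices-in-Apow : ∀ t ρ → Jpow t ρ → ∀ x → Apow t (slice x ρ)
  slices-in-Apow zero    ρ _   x = slice∈ZH x ρ
  slices-in-Apow (suc t) ρ ρ∈ x = span-map (slice-additive x) onGen ρ∈
    where
    onGen : ∀ X → (∃[ j ] ∃[ b ] (InJ j × Jpow t b × X ≈ (j ⊛ b))) → Apow (suc t) (slice x X)
    onGen X (j , b , j∈J , b∈ , X≈jb) =
      resp (IsAdditive.pres-≈ (slice-additive x) (λ y → sym (X≈jb y)))
           (slices-of-product t b (slices-in-Apow t b b∈) j∈J x)

  ψ-Jpow : ∀ t ρ → Jpow t ρ → TensA t (ψ ρ)
  ψ-Jpow t ρ ρ∈ = rows⇒TensA t (ψ ρ) (λ x → slice x ρ) (ψ-eval ρ) (slices-in-Apow t ρ ρ∈)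

  -- Part (iv), injectivity: ρ is the sum, over coset representatives x,
  -- of (slice of ρ at x) · x; if all slices lie in A^{t+1} ⊂ J^{t+1}, so does ρ.

  A⊂J : ∀ {a} → InA a → InJ a
  A⊂J {a} a∈A = gen (δ e , a , a∈A , λ z → sym (δe⊛ a z))

  Apow⊂Jpow : ∀ s {f} → Apow s f → Jpow s f
  Apow⊂Jpow zero    _  = tt
  Apow⊂Jpow (suc s) f∈ = span-mono (λ { (a , b , a∈A , b∈ , f≈ab) → a , b , A⊂J a∈A , Apow⊂Jpow s b∈ , f≈ab }) f∈

  Jpow-⊛ʳ : ∀ s r {f} → Jpow s f → Jpow s (f ⊛ r)
  Jpow-⊛ʳ zero    r _  = tt
  Jpow-⊛ʳ (suc s) r f∈ = span-map (⊛ʳ-additive r) onGen f∈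
    where
    onGen : ∀ X → (∃[ j ] ∃[ b ] (InJ j × Jpow s b × X ≈ (j ⊛ b))) → Jpow (suc s) (X ⊛ r)
    onGen X (j , b , j∈J , b∈ , X≈jb) =
      gen (j , b ⊛ r , j∈J , Jpow-⊛ʳ s r b∈ , λ z → trans (IsAdditive.pres-≈ (⊛ʳ-additive r) X≈jb z) (⊛-assoc j b r z))

  sameCoset : Fin n → Fin n → Bool
  sameCoset z x = isH (z ∙ (x ⁻¹))

  sameCoset-refl : ∀ z → sameCoset z z ≡ true
  sameCoset-refl z = trans (cong isH (inverseʳ z)) e∈

  sameCoset-trans : ∀ {z x} → sameCoset z x ≡ true → sameCoset x ≗ sameCoset z
  sameCoset-trans {z} {x} zx y = begin
    isH (x ∙ (y ⁻¹))                          ≡⟨ sym (isH-mulˡ (z ∙ (x ⁻¹)) (x ∙ (y ⁻¹)) zx) ⟩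
    isH ((z ∙ (x ⁻¹)) ∙ (x ∙ (y ⁻¹)))         ≡⟨ cong isH (trans (assoc z (x ⁻¹) _) (cong (z ∙_) (\\-leftDividesʳ x (y ⁻¹)))) ⟩
    isH (z ∙ (y ⁻¹))                          ∎

  -- x is the chosen representative of its coset: its least element.
  isRep : Fin n → Bool
  isRep x = first (sameCoset x) x

  rep-selects : ∀ z x c →
    (if isRep x then (if sameCoset z x then c else 0ℤ) else 0ℤ) ≡ (if first (sameCoset z) x then c else 0ℤ)
  rep-selects z x c with sameCoset z x in zx
  ... | true  = cong (λ b → if b then c else 0ℤ) (first-cong (sameCoset-trans zx) x)
  ... | false with first (sameCoset z) x in first-zx
  ...   | true with () ← trans (sym (first⇒ (sameCoset z) x first-zx)) zx
  ...   | false with isRep x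
  ...     | true  = refl
  ...     | false = refl

  coset-part : ∀ ρ x z → (slice x ρ ⊛ δ x) z ≡ (if sameCoset z x then ρ z else 0ℤ)
  coset-part ρ x z = trans (⊛δ (slice x ρ) x z)
                           (cong (λ u → if sameCoset z x then ρ u else 0ℤ) (//-rightDividesˡ x z))

  reconstruction : ∀ ρ z → sum (λ x → if isRep x then (slice x ρ ⊛ δ x) z else 0ℤ) ≡ ρ z
  reconstruction ρ z = begin
    sum (λ x → if isRep x then (slice x ρ ⊛ δ x) z else 0ℤ)
      ≡⟨ sum-cong-≗ {n} (λ x → cong (λ u → if isRep x then u else 0ℤ) (coset-part ρ x z)) ⟩
    sum (λ x → if isRep x then (if sameCoset z x then ρ z else 0ℤ) else 0ℤ)
      ≡⟨ sum-cong-≗ {n} (λ x → rep-selects z x (ρ z)) ⟩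
    sum (λ x → if first (sameCoset z) x then ρ z else 0ℤ)
      ≡⟨ sum-first (sameCoset z) (sameCoset-refl z) (ρ z) ⟩
    ρ z ∎

  graded-injective : ∀ t ρ → Jpow t ρ → TensA (suc t) (ψ ρ) → Jpow (suc t) ρ
  graded-injective t ρ _ ψρ∈ =
    resp (reconstruction ρ)
         (span-sum _ λ x → span-if (isRep x) (Jpow-⊛ʳ (suc t) (δ x) (Apow⊂Jpow (suc t) (slice∈Apow x))))
    where
    slice∈Apow : ∀ x → Apow (suc t) (slice x ρ)
    slice∈Apow x = resp (ψ-eval ρ x) (TensA⇒rows t (ψ ρ) ψρ∈ x)

  -- Part (iv), the composite: for α ∈ A^t the row x of ψ(α g) - ι(gH) ⊗ α
  -- is (k⁻¹ - 1) α with k = x g⁻¹ if x ∈ gH, and 0 otherwise.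

  ι-eval : ∀ g x → ι g x ≡ (if isH (x ∙ (g ⁻¹)) then 1ℤ else 0ℤ)
  ι-eval g x = cong (λ u → if isH u then 1ℤ else 0ℤ) (comm (g ⁻¹) x)

  composite-row-eval : ∀ g α x y →
    row (ψ (α ⊛ δ g) ⊝ (ι g ⊗ α)) x y ≡ slice (x ∙ (g ⁻¹)) α y + - ((if isH (x ∙ (g ⁻¹)) then 1ℤ else 0ℤ) * α y)
  composite-row-eval g α x y =
    cong₂ (λ u v → u + - (v * α y)) (trans (ψ-eval (α ⊛ δ g) x y) (slice-⊛δ x α g y)) (ι-eval g x)

  composite-row : ∀ t g {α} → Apow t α → ∀ x → Apow (suc t) (row (ψ (α ⊛ δ g) ⊝ (ι g ⊗ α)) x)
  composite-row t g {α} α∈ x with isH (x ∙ (g ⁻¹)) in k∈?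
  ... | true  = resp (λ y → sym (on-coset y))
                     (gen (δ (k ⁻¹) ⊝ δ e , α , translate-diff∈A (⁻¹∈ k k∈?) , α∈ , λ _ → refl))
    where
    k : Fin n
    k = x ∙ (g ⁻¹)
    on-coset : ∀ y → row (ψ (α ⊛ δ g) ⊝ (ι g ⊗ α)) x y ≡ ((δ (k ⁻¹) ⊝ δ e) ⊛ α) y
    on-coset y = begin
      row (ψ (α ⊛ δ g) ⊝ (ι g ⊗ α)) x y
        ≡⟨ trans (composite-row-eval g α x y) (cong (λ b → slice k α y + - ((if b then 1ℤ else 0ℤ) * α y)) k∈?) ⟩
      slice k α y + - (1ℤ * α y)
        ≡⟨ cong₂ (λ u v → u + - v) (slice-ZH-inside (Apow⊂ZH t α∈) k∈? y)
                                   (trans (*-identityˡ (α y)) (sym (δe⊛ α y))) ⟩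
      (δ (k ⁻¹) ⊛ α) y + - (δ e ⊛ α) y
        ≡⟨ sym (cong (λ v → (δ (k ⁻¹) ⊛ α) y + v) (IsAdditive.pres-⊖ (⊛ʳ-additive α) (δ e) y)) ⟩
      (δ (k ⁻¹) ⊛ α) y + ((⊖ δ e) ⊛ α) y
        ≡⟨ sym (IsAdditive.pres-⊕ (⊛ʳ-additive α) (δ (k ⁻¹)) (⊖ δ e) y) ⟩
      ((δ (k ⁻¹) ⊝ δ e) ⊛ α) y ∎
  ... | false = resp (λ y → sym (off-coset y)) zro
    where
    k : Fin n
    k = x ∙ (g ⁻¹)
    off-coset : ∀ y → row (ψ (α ⊛ δ g) ⊝ (ι g ⊗ α)) x y ≡ 0ℤ
    off-coset y = begin
      row (ψ (α ⊛ δ g) ⊝ (ι g ⊗ α)) x y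
        ≡⟨ trans (composite-row-eval g α x y) (cong (λ b → slice k α y + - ((if b then 1ℤ else 0ℤ) * α y)) k∈?) ⟩
      slice k α y + - (0ℤ * α y)
        ≡⟨ cong (λ u → u + - (0ℤ * α y)) (slice-ZH-outside (Apow⊂ZH t α∈) k∈? y) ⟩
      0ℤ + - (0ℤ * α y)
        ≡⟨ cong (λ v → 0ℤ + - v) (*-zeroˡ (α y)) ⟩
      0ℤ ∎

  composite-is-ι⊗1 : ∀ t g α → Apow t α → TensA (suc t) (ψ (α ⊛ δ g) ⊝ (ι g ⊗ α))
  composite-is-ι⊗1 t g α α∈ = rows⇒TensA (suc t) _ (row _) (λ _ _ → refl) (composite-row t g α∈)

lemma5p6 : (G : FinAbGroup) (H : Subgroup G) → GroupRing.Lemma5p6 G H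
lemma5p6 G H =
    (ψ-additive , ψ-linear , ψ-injective)
  , ψ-H-equivariant
  , ψ-Jpow
  , (graded-injective , composite-is-ι⊗1)
  where open Lemma5p6Proof G H
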